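{- Let $H$ be an equibipartite tree on $2l$ vertices. If $H$ does not contain a perfect matching, then there is a partition $V(H)=V_1\cup V_2$ with $|V_1|<|V_2|$ such that $V_2$ induces no edges of $H$ and $V_1$ induces exactly one edge of $H$.
   Context: A tree is equibipartite if the two classes of its bipartition have the same size. -}

module Defs where

open import Data.Nat using (ℕ; zero; suc; _+_; _<_; _≤_)
open import Data.Fin using (Fin; zero; suc)
open import Data.Bool using (Bool; true; false; T; not)
open import Data.List using (List; []; _∷_; length; last)
open import Data.List.Relation.Unary.Unique.Propositional using (Unique)
open import Data.Maybe using (Maybe; just)
open import Data.Product using (Σ; _×_; _,_; ∃; ∃-syntax)
open import Data.Sum using (_⊎_)
open import Data.Unit using (⊤)
open import Data.Empty using (⊥)
open import Relation.Nullary using (¬_)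
open import Relation.Binary.PropositionalEquality using (_≡_; _≢_)

record Graph (n : ℕ) : Set where
  field
    adj   : Fin n → Fin n → Bool
    sym   : ∀ u v → adj u v ≡ adj v u
    irrefl : ∀ v → adj v v ≡ false

open Graph public

Adj : ∀ {n} → Graph n → Fin n → Fin n → Set
Adj G u v = T (adj G u v)

Chain : ∀ {n} → Graph n → List (Fin n) → Set
Chain G []           = ⊤
Chain G (x ∷ [])     = ⊤
Chain G (x ∷ y ∷ xs) = Adj G x y × Chain G (y ∷ xs)

Walk : ∀ {n} → Graph n → Fin n → Fin n → List (Fin n) → Set
Walk G u v []       = ⊥
Walk G u v (x ∷ xs) = (x ≡ u) × (last (x ∷ xs) ≡ just v) × Chain G (x ∷ xs)

Connected : ∀ {n} → Graph n → Set
Connected {n} G = ∀ (u v : Fin n) → ∃[ ws ] Walk G u v ws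

IsCycle : ∀ {n} → Graph n → List (Fin n) → Set
IsCycle G xs = (3 ≤ length xs) × Unique xs ×
               (Σ _ λ x₀ → Σ _ λ xₖ →
                  Walk G x₀ xₖ xs × Adj G xₖ x₀)

Acyclic : ∀ {n} → Graph n → Set
Acyclic G = ∀ xs → ¬ IsCycle G xs

IsTree : ∀ {n} → Graph n → Set
IsTree G = Connected G × Acyclic G

count : ∀ {n} → (Fin n → Bool) → ℕ
count {zero}  f = 0
count {suc n} f with f zero
... | true  = suc (count (λ i → f (suc i)))
... | false = count (λ i → f (suc i))

ProperColouring : ∀ {n} → Graph n → (Fin n → Bool) → Set
ProperColouring G c = ∀ u v → Adj G u v → c u ≢ c v

Equibipartite : ∀ {n} → Graph n → Set
Equibipartite G = ∃[ c ] (ProperColouring G c ×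
                          count c ≡ count (λ v → not (c v)))

-- a perfect matching, given as the partner map: every vertex v is matched
-- to exactly one vertex m v ≠ v, along an edge, and m is an involution
PerfectMatching : ∀ {n} → Graph n → Set
PerfectMatching {n} G =
  Σ (Fin n → Fin n) λ m → ∀ v → Adj G v (m v) × m (m v) ≡ v

InducesNoEdge : ∀ {n} → Graph n → (Fin n → Bool) → Set
InducesNoEdge G X = ∀ u v → T (X u) → T (X v) → ¬ Adj G u v

InducesExactlyOneEdge : ∀ {n} → Graph n → (Fin n → Bool) → Set
InducesExactlyOneEdge G X =
  Σ _ λ a → Σ _ λ b → T (X a) × T (X b) × Adj G a b ×
    (∀ u v → T (X u) → T (X v) → Adj G u v →
       (u ≡ a × v ≡ b) ⊎ (u ≡ b × v ≡ a))

-- For an edge vw of the tree, colour every vertex x by the parity of its distance to the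
-- endpoint of vw on x's side of the edge.  The odd vertices form a set V₂ = cut v w which is
-- independent, and whose complement induces only the edge vw; so it suffices to find an edge
-- whose cut is the larger side.  Let #even v w and #odd v w count the vertices of the branch
-- of w at v at even and odd distance from w.  Since the colour classes have equal size l,
-- #even v w + #odd w v = l = #even w v + #odd v w along each edge, and summing over the
-- neighbours w of v gives Σ #even v w = l = 1 + Σ #odd v w.  If no cut is larger than its
-- complement, then #odd v w ≤ #even v w along every edge, so each v has exactly one neighbour
-- with #odd v w < #even v w; by the edge identity this relation is symmetric, hence it is a
-- perfect matching.
module Submission where

import Algebra.Properties.CommutativeMonoid.Sum as CommutativeMonoidSum
open import Data.Bool using (Bool; true; false; not; T; _∧_; _xor_; if_then_else_)
open import Data.Bool.Properties
  using ( ∧-zeroʳ; ∧-identityʳ; if-eta; if-float; ¬-not; not-¬; not-involutive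
        ; not-distribˡ-xor; not-distribʳ-xor; xor-identityʳ; xor-comm; xor-same; T-≡; T-not-≡ )
open import Data.Empty using (⊥; ⊥-elim)
open import Data.Fin using (Fin; zero; suc; _≟_)
open import Data.Fin.Properties using (any?)
open import Data.List using (List; []; _∷_; length; last)
open import Data.List.Membership.Propositional using (_∈_)
open import Data.List.Relation.Unary.All using (All; []; _∷_)
open import Data.List.Relation.Unary.All.Properties using (¬Any⇒All¬)
open import Data.List.Relation.Unary.AllPairs using ([]; _∷_)
open import Data.List.Relation.Unary.Any using (here; there)
open import Data.List.Relation.Unary.Unique.Propositional using (Unique)
open import Data.Maybe using (just)
open import Data.Nat using (ℕ; zero; suc; _+_; _*_; _≤_; _<_; z≤n; s≤s; _<?_; _≤?_)
open import Data.Nat.Properties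
  using ( +-0-commutativeMonoid; +-identityʳ; +-suc; +-comm; ≤-trans; ≤-reflexive; n≮n
        ; ≰⇒>; <⇒≱; ≮⇒≥; +-mono-≤; +-mono-<; +-mono-<-≤; +-mono-≤-<; +-monoʳ-<; +-cancelʳ-<
        ; module ≤-Reasoning )
open import Data.Product as Product using (Σ; Σ-syntax; ∃-syntax; _×_; _,_; proj₁; proj₂)
open import Data.Sum as Sum using (_⊎_; inj₁; inj₂)
open import Defs hiding (sym)
open import Function using (_∘_; id; _$_; case_of_)
open import Function.Bundles using (module Equivalence)
open import Level using (0ℓ)
open import Relation.Binary.PropositionalEquality
open import Relation.Nullary using (¬_; Dec; does; yes; no; contradiction)
open import Relation.Nullary.Decidable using (T?; _×-dec_; toSum; decidable-stable)
open import Relation.Unary using (Pred; U; _⊆_; _∩_)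

open CommutativeMonoidSum +-0-commutativeMonoid
  using (sum-syntax; sum-cong-≗; ∑-distrib-+; ∑-comm; sum-replicate-zero)

private variable n : ℕ

𝟙 : Bool → ℕ
𝟙 b = if b then 1 else 0

count≡∑ : (f : Fin n → Bool) → count f ≡ ∑[ x < n ] 𝟙 (f x)
count≡∑ {zero}  f = refl
count≡∑ {suc n} f with f zero
... | true  = cong suc (count≡∑ (f ∘ suc))
... | false = count≡∑ (f ∘ suc)

count-cong : {f g : Fin n → Bool} → f ≗ g → count f ≡ count g
count-cong {n} {f} {g} f≗g = begin
  count f             ≡⟨ count≡∑ f ⟩
  ∑[ x < n ] 𝟙 (f x)  ≡⟨ sum-cong-≗ (cong 𝟙 ∘ f≗g) ⟩
  ∑[ x < n ] 𝟙 (g x)  ≡⟨ count≡∑ g ⟨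
  count g             ∎
  where open ≡-Reasoning

count-false : {f : Fin n → Bool} → (∀ x → f x ≡ false) → count f ≡ 0
count-false {n} {f} f≡false = begin
  count f             ≡⟨ count≡∑ f ⟩
  ∑[ x < n ] 𝟙 (f x)  ≡⟨ sum-cong-≗ (cong 𝟙 ∘ f≡false) ⟩
  ∑[ x < n ] 0        ≡⟨ sum-replicate-zero n ⟩
  0                   ∎
  where open ≡-Reasoning

count-if : (s f g : Fin n → Bool) →
           count (λ x → if s x then f x else g x) ≡
           count (λ x → s x ∧ f x) + count (λ x → not (s x) ∧ g x)
count-if {n} s f g = begin
  count (λ x → if s x then f x else g x)            ≡⟨ count≡∑ (λ x → if s x then f x else g x) ⟩
  ∑[ x < n ] 𝟙 (if s x then f x else g x)           ≡⟨ sum-cong-≗ split ⟩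
  ∑[ x < n ] (𝟙 (s∧f x) + 𝟙 (¬s∧g x))               ≡⟨ ∑-distrib-+ (𝟙 ∘ s∧f) (𝟙 ∘ ¬s∧g) ⟩
  ∑[ x < n ] 𝟙 (s∧f x) + ∑[ x < n ] 𝟙 (¬s∧g x)      ≡⟨ cong₂ _+_ (count≡∑ s∧f) (count≡∑ ¬s∧g) ⟨
  count s∧f + count ¬s∧g                             ∎
  where
  open ≡-Reasoning
  s∧f ¬s∧g : Fin n → Bool
  s∧f x = s x ∧ f x
  ¬s∧g x = not (s x) ∧ g x
  split : ∀ x → 𝟙 (if s x then f x else g x) ≡ 𝟙 (s∧f x) + 𝟙 (¬s∧g x)
  split x with s x
  ... | true  = sym (+-identityʳ _)
  ... | false = refl

count-singleton : (v : Fin n) (k : Fin n → Bool) →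
                  count (λ x → does (x ≟ v) ∧ k x) ≡ 𝟙 (k v)
count-singleton v k = trans (count≡∑ (λ x → does (x ≟ v) ∧ k x)) (∑-singleton v k)
  where
  ∑-singleton : ∀ {n} (v : Fin n) (k : Fin n → Bool) →
                ∑[ x < n ] 𝟙 (does (x ≟ v) ∧ k x) ≡ 𝟙 (k v)
  ∑-singleton {suc n} zero    k =
    trans (cong (𝟙 (k zero) +_) (sum-replicate-zero n)) (+-identityʳ _)
  ∑-singleton {suc n} (suc v) k = ∑-singleton v (k ∘ suc)

count-split : (s f : Fin n → Bool) →
              count f ≡ count (λ x → s x ∧ f x) + count (λ x → not (s x) ∧ f x)
count-split s f = trans (count-cong (λ x → sym (if-eta (s x)))) (count-if s f f)

count-remove : (v : Fin n) (k : Fin n → Bool) →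
               count k ≡ 𝟙 (k v) + count (λ x → not (does (x ≟ v)) ∧ k x)
count-remove v k = trans (count-split (λ x → does (x ≟ v)) k)
                         (cong (_+ count (λ x → not (does (x ≟ v)) ∧ k x)) (count-singleton v k))

count-unique : {f : Fin n → Bool} (v : Fin n) → f v ≡ true →
               (∀ x → f x ≡ true → x ≡ v) → count f ≡ 1
count-unique {f = f} v fv only-v = begin
  count f                                          ≡⟨ count-remove v f ⟩
  𝟙 (f v) + count (λ x → not (does (x ≟ v)) ∧ f x) ≡⟨ cong₂ _+_ (cong 𝟙 fv) (count-false others) ⟩
  1                                                ∎
  where
  open ≡-Reasoning
  others : ∀ x → not (does (x ≟ v)) ∧ f x ≡ false
  others x with x ≟ v | f x in fx
  ... | yes _  | _     = refl
  ... | no  _  | false = refl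
  ... | no x≢v | true  = contradiction (only-v x fx) x≢v

count-comm : ∀ {m} (f : Fin m → Fin n → Bool) →
             ∑[ i < m ] count (f i) ≡ ∑[ j < n ] count (λ i → f i j)
count-comm {n} {m} f = begin
  ∑[ i < m ] count (f i)                ≡⟨ sum-cong-≗ (λ i → count≡∑ (f i)) ⟩
  ∑[ i < m ] ∑[ j < n ] 𝟙 (f i j)       ≡⟨ ∑-comm (λ i j → 𝟙 (f i j)) ⟩
  ∑[ j < n ] ∑[ i < m ] 𝟙 (f i j)       ≡⟨ sum-cong-≗ (λ j → count≡∑ (λ i → f i j)) ⟨
  ∑[ j < n ] count (λ i → f i j)        ∎
  where open ≡-Reasoning

∑-mono-≤ : {f g : Fin n → ℕ} → (∀ i → f i ≤ g i) → ∑[ i < n ] f i ≤ ∑[ i < n ] g i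
∑-mono-≤ {zero}  f≤g = z≤n
∑-mono-≤ {suc n} f≤g = +-mono-≤ (f≤g zero) (∑-mono-≤ (f≤g ∘ suc))

∑-mono-< : {f g : Fin n → ℕ} → (∀ i → f i ≤ g i) → ∀ j → f j < g j →
           ∑[ i < n ] f i < ∑[ i < n ] g i
∑-mono-< f≤g zero    fj<gj = +-mono-<-≤ fj<gj (∑-mono-≤ (f≤g ∘ suc))
∑-mono-< f≤g (suc j) fj<gj = +-mono-≤-< (f≤g zero) (∑-mono-< (f≤g ∘ suc) j fj<gj)

+-mono-<₂ : ∀ {a b c d} → a < b → c < d → 2 + (a + c) ≤ b + d
+-mono-<₂ {a} {b} {c} {d} a<b c<d = subst (_≤ b + d) (cong suc (+-suc a c)) (+-mono-≤ a<b c<d)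

∑-mono-<₂ : {f g : Fin n → ℕ} → (∀ i → f i ≤ g i) →
            ∀ j k → j ≢ k → f j < g j → f k < g k → 2 + ∑[ i < n ] f i ≤ ∑[ i < n ] g i
∑-mono-<₂ f≤g zero    zero    0≢0 _     _     = contradiction refl 0≢0
∑-mono-<₂ f≤g zero    (suc k) _   fj<gj fk<gk = +-mono-<₂ fj<gj (∑-mono-< (f≤g ∘ suc) k fk<gk)
∑-mono-<₂ f≤g (suc j) zero    _   fj<gj fk<gk = +-mono-<₂ fk<gk (∑-mono-< (f≤g ∘ suc) j fj<gj)
∑-mono-<₂ {f = f} f≤g (suc j) (suc k) j≢k fj<gj fk<gk =
  ≤-trans (≤-reflexive (sym (trans (+-suc (f zero) _) (cong suc (+-suc (f zero) _)))))
    (+-mono-≤ (f≤g zero) (∑-mono-<₂ (f≤g ∘ suc) j k (j≢k ∘ cong suc) fj<gj fk<gk))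

∑-<⇒∃ : (f g : Fin n → ℕ) → ∑[ i < n ] f i < ∑[ i < n ] g i → ∃[ i ] f i < g i
∑-<⇒∃ {suc n} f g ∑f<∑g with f zero <? g zero
... | yes f₀<g₀ = zero , f₀<g₀
... | no  f₀≮g₀ = Product.map suc id (∑-<⇒∃ (f ∘ suc) (g ∘ suc) (≰⇒> λ ∑g′≤∑f′ →
  <⇒≱ ∑f<∑g (+-mono-≤ (≮⇒≥ f₀≮g₀) ∑g′≤∑f′)))

surplus-transfer : ∀ {a b c d} → a + d ≡ c + b → b < a → d < c
surplus-transfer {a} {b} {c} {d} a+d≡c+b b<a = +-cancelʳ-< b d c (begin-strict
  d + b  <⟨ +-monoʳ-< d b<a ⟩
  d + a  ≡⟨ +-comm d a ⟩
  a + d  ≡⟨ a+d≡c+b ⟩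
  c + b  ∎)
  where open ≤-Reasoning

no-deficit : ∀ {a b c d} → a + d ≡ c + b → ¬ (a + c < b + d) → b ≤ a
no-deficit {a} {b} {c} {d} a+d≡c+b a+c≮b+d with b ≤? a
... | yes b≤a = b≤a
... | no  b≰a = contradiction (+-mono-< a<b (surplus-transfer b+c≡d+a a<b)) a+c≮b+d
  where
  a<b : a < b
  a<b = ≰⇒> b≰a
  b+c≡d+a : b + c ≡ d + a
  b+c≡d+a = trans (+-comm b c) (trans (sym a+d≡c+b) (+-comm a d))

module _ (G : Graph n) (P Q : Fin n → Fin n → ℕ)
         (Q≤P : ∀ v w → Q v w ≤ P v w)
         (∑P≡1+∑Q : ∀ v → ∑[ w < n ] P v w ≡ suc (∑[ w < n ] Q v w))
         (surplus-sym : ∀ {v w} → Q v w < P v w → Q w v < P w v)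
         (surplus⇒Adj : ∀ {v w} → Q v w < P v w → Adj G v w) where

  private
    surplus : ∀ v → ∃[ w ] Q v w < P v w
    surplus v = ∑-<⇒∃ (Q v) (P v) (≤-reflexive (sym (∑P≡1+∑Q v)))

    surplus-unique : ∀ {v w w′} → Q v w < P v w → Q v w′ < P v w′ → w ≡ w′
    surplus-unique {v} {w} {w′} Qvw<Pvw Qvw′<Pvw′ with w ≟ w′
    ... | yes w≡w′ = w≡w′
    ... | no  w≢w′ = contradiction
      (≤-trans (∑-mono-<₂ (Q≤P v) w w′ w≢w′ Qvw<Pvw Qvw′<Pvw′) (≤-reflexive (∑P≡1+∑Q v)))
      (n≮n _)

    partner : Fin n → Fin n
    partner v = proj₁ (surplus v)

  surplus⇒perfectMatching : PerfectMatching G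
  surplus⇒perfectMatching = partner , λ v →
    surplus⇒Adj (proj₂ (surplus v)) ,
    surplus-unique (proj₂ (surplus (partner v))) (surplus-sym (proj₂ (surplus v)))

module Walks {n} (G : Graph n) where

  open import Data.List.Membership.DecPropositional (_≟_ {n}) using (_∈?_)

  Adj-sym : ∀ {x y} → Adj G x y → Adj G y x
  Adj-sym {x} {y} = subst T (Graph.sym G x y)

  data WalkIn (P : Pred (Fin n) 0ℓ) : Fin n → Fin n → Set where
    stay : ∀ {x} → P x → WalkIn P x x
    step : ∀ {x y z} → P x → Adj G x y → WalkIn P y z → WalkIn P x z

  private variable
    P Q : Pred (Fin n) 0ℓ
    v w x y z : Fin n

  Adj⇒≢ : Adj G v w → v ≢ w
  Adj⇒≢ {v} v~w refl = subst T (Graph.irrefl G v) v~w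

  vertices : WalkIn P x y → List (Fin n)
  vertices (stay {x} _)     = x ∷ []
  vertices (step {x} _ _ p) = x ∷ vertices p

  source∈ : WalkIn P x y → P x
  source∈ (stay px)     = px
  source∈ (step px _ _) = px

  target∈ : WalkIn P x y → P y
  target∈ (stay py)     = py
  target∈ (step _ _ p) = target∈ p

  weaken : P ⊆ Q → WalkIn P x y → WalkIn Q x y
  weaken P⊆Q (stay px)     = stay (P⊆Q px)
  weaken P⊆Q (step px a p) = step (P⊆Q px) a (weaken P⊆Q p)

  _++_ : WalkIn P x y → WalkIn P y z → WalkIn P x z
  stay _     ++ q = q
  step px a p ++ q = step px a (p ++ q)

  reverse : WalkIn P x y → WalkIn P y x
  reverse (stay px)     = stay px
  reverse (step px a p) = reverse p ++ step (source∈ p) (Adj-sym a) (stay px)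

  connected⇒walkIn : Connected G → ∀ x y → WalkIn U x y
  connected⇒walkIn connected x y with connected x y
  ... | z ∷ zs , refl , last≡y , chain = fromChain z zs last≡y chain
    where
    fromChain : ∀ {y} z zs → last (z ∷ zs) ≡ just y → Chain G (z ∷ zs) → WalkIn U z y
    fromChain z []        refl   _           = stay _
    fromChain z (z′ ∷ zs) last≡y (a , chain) = step _ a (fromChain z′ zs last≡y chain)

  lastStep : v ≢ x → WalkIn P x v → ∃[ w ] Adj G w v × WalkIn (P ∩ (v ≢_)) x w
  lastStep v≢x (stay _) = contradiction refl v≢x
  lastStep {v} v≢x (step {y = y} px a p) with v ≟ y
  ... | yes refl = _ , a , stay (px , v≢x)
  ... | no  v≢y  = Product.map₂ (Product.map₂ (step (px , v≢x) a)) (lastStep v≢y p)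

  suffixFrom : (p : WalkIn P y z) → x ∈ vertices p →
               Σ[ q ∈ WalkIn P x z ] (Unique (vertices p) → Unique (vertices q))
  suffixFrom (stay py)          (here refl)  = stay py , id
  suffixFrom p@(step _ _ _)     (here refl)  = p , id
  suffixFrom (step _ _ p)       (there x∈p)  =
    Product.map₂ (λ unique⇒ → λ { (_ ∷ unique-p) → unique⇒ unique-p }) (suffixFrom p x∈p)

  shortcut : WalkIn P x y → Σ[ q ∈ WalkIn P x y ] Unique (vertices q)
  shortcut (stay px) = stay px , [] ∷ []
  shortcut {x = x} (step px a p) with shortcut p
  ... | q , unique-q with x ∈? vertices q
  ...   | yes x∈q = Product.map₂ (_$ unique-q) (suffixFrom q x∈q)
  ...   | no  x∉q = step px a q , ¬Any⇒All¬ (vertices q) x∉q ∷ unique-q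

  vertices∈ : (p : WalkIn P x y) → All P (vertices p)
  vertices∈ (stay px)     = px ∷ []
  vertices∈ (step px _ p) = px ∷ vertices∈ p

  last-vertices : (p : WalkIn P x y) → last (vertices p) ≡ just y
  last-vertices (stay _)                = refl
  last-vertices (step _ _ (stay _))     = refl
  last-vertices (step _ _ p@(step _ _ _)) = last-vertices p

  chain-vertices : (p : WalkIn P x y) → Chain G (vertices p)
  chain-vertices (stay _)                  = _
  chain-vertices (step _ a (stay _))       = a , _
  chain-vertices (step _ a p@(step _ _ _)) = a , chain-vertices p

  length-vertices : (p : WalkIn P x y) → 1 ≤ length (vertices p)
  length-vertices (stay _)     = s≤s z≤n
  length-vertices (step _ _ _) = s≤s z≤n

  acyclic-fork : Acyclic G → Adj G w v → Adj G z v → WalkIn (v ≢_) w z → w ≡ z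
  acyclic-fork {w} {v} {z} acyclic w~v z~v p with shortcut p
  ... | stay _ , _ = refl
  ... | q@(step _ _ r) , unique-q = contradiction cycle (acyclic (v ∷ vertices q))
    where
    cycle : IsCycle G (v ∷ vertices q)
    cycle = s≤s (s≤s (length-vertices r)) , vertices∈ q ∷ unique-q ,
            v , z , (refl , last-vertices q , Adj-sym w~v , chain-vertices q) , z~v

module Branches {n} {G : Graph n} (connected : Connected G) (acyclic : Acyclic G) where

  open Walks G

  private variable
    v w x y : Fin n

  Branch : Fin n → Fin n → Pred (Fin n) 0ℓ
  Branch v w x = WalkIn (v ≢_) x w

  ∉Branch : ¬ Branch v w v
  ∉Branch p = source∈ p refl

  branch-unique : Adj G w v → Adj G y v → Branch v w x → Branch v y x → w ≡ y
  branch-unique w~v y~v p q = acyclic-fork acyclic w~v y~v (reverse p ++ q)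

  branch-exists : v ≢ x → ∃[ w ] Adj G w v × Branch v w x
  branch-exists v≢x =
    Product.map₂ (Product.map₂ (weaken proj₂)) (lastStep v≢x (connected⇒walkIn connected _ _))

  branch-either : v ≢ w → ∀ x → Branch v w x ⊎ Branch w v x
  branch-either {v} {w} v≢w x = along (connected⇒walkIn connected x w)
    where
    along : ∀ {x} → WalkIn U x w → Branch v w x ⊎ Branch w v x
    along (stay _) = inj₁ (stay v≢w)
    along {x} (step _ x~y p) with v ≟ x | w ≟ x
    ... | yes refl | _        = inj₂ (stay (v≢w ∘ sym))
    ... | no  v≢x  | yes refl = inj₁ (stay v≢x)
    ... | no  v≢x  | no  w≢x  = Sum.map (step v≢x x~y) (step w≢x x~y) (along p)

  branch-disjoint : Adj G v w → Branch v w x → Branch w v x → ⊥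
  branch-disjoint v~w p q with lastStep (source∈ p) q
  ... | y , y~v , r = proj₁ (target∈ r) (branch-unique (Adj-sym v~w) y~v p (weaken proj₂ r))

  branch-cross : Adj G v w → Adj G x y → Branch w v x → Branch v w y → x ≡ v × y ≡ w
  branch-cross {v} {w} {x} {y} v~w x~y p q = x≡v , y≡w
    where
    x≡v : x ≡ v
    x≡v with v ≟ x
    ... | yes v≡x = sym v≡x
    ... | no  v≢x = ⊥-elim (branch-disjoint v~w (step v≢x x~y q) p)
    y≡w : y ≡ w
    y≡w with w ≟ y
    ... | yes w≡y = sym w≡y
    ... | no  w≢y = ⊥-elim (branch-disjoint v~w q (step w≢y (Adj-sym x~y) p))

  branch? : Adj G v w → ∀ x → Dec (Branch v w x)
  branch? v~w x with branch-either (Adj⇒≢ v~w) x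
  ... | inj₁ p = yes p
  ... | inj₂ q = no λ p → branch-disjoint v~w p q

  -- A non-adjacent pair v, w gets the empty branch, so a sum over all w is a sum over the
  -- neighbours of v.
  inBranch : Fin n → Fin n → Fin n → Bool
  inBranch v w x with T? (adj G v w)
  ... | yes v~w = does (branch? v~w x)
  ... | no  _   = false

  inBranch-sound : inBranch v w x ≡ true → Adj G v w × Branch v w x
  inBranch-sound {v} {w} {x} with T? (adj G v w)
  ... | no _ = λ ()
  ... | yes v~w with branch? v~w x
  ...   | yes p = λ _ → v~w , p
  ...   | no  _ = λ ()

  inBranch-complete : Adj G v w → Branch v w x → inBranch v w x ≡ true
  inBranch-complete {v} {w} {x} v~w p with T? (adj G v w)
  ... | no ¬v~w = contradiction v~w ¬v~w
  ... | yes v~w′ with branch? v~w′ x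
  ...   | yes _  = refl
  ...   | no  ¬p = contradiction p ¬p

  inBranch-flip : Adj G v w → ∀ x → inBranch w v x ≡ not (inBranch v w x)
  inBranch-flip {v} {w} v~w x with inBranch v w x in x∈?
  ... | true  = ¬-not λ x∈′ →
    branch-disjoint v~w (proj₂ (inBranch-sound x∈?)) (proj₂ (inBranch-sound x∈′))
  ... | false with branch-either (Adj⇒≢ v~w) x
  ...   | inj₁ p = case trans (sym x∈?) (inBranch-complete v~w p) of λ ()
  ...   | inj₂ q = inBranch-complete (Adj-sym v~w) q

  inBranch≡false⇒Branch : Adj G v w → inBranch v w x ≡ false → Branch w v x
  inBranch≡false⇒Branch {v} {w} {x} v~w x∉ =
    proj₂ (inBranch-sound (trans (inBranch-flip v~w x) (cong not x∉)))

  #branches∋ : ∀ v x → count (λ w → inBranch v w x) ≡ 𝟙 (not (does (x ≟ v)))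
  #branches∋ v x with x ≟ v
  ... | yes refl = count-false λ w → ¬-not (∉Branch ∘ proj₂ ∘ inBranch-sound {v} {w})
  ... | no  x≢v with branch-exists (x≢v ∘ sym)
  ...   | w , w~v , p = count-unique w (inBranch-complete (Adj-sym w~v) p) λ y y∈ →
            let v~y , q = inBranch-sound y∈ in branch-unique (Adj-sym v~y) w~v q p

module EdgeCut {n} {G : Graph n} (connected : Connected G) (acyclic : Acyclic G)
               (c : Fin n → Bool) (proper : ProperColouring G c)
               (balanced : count c ≡ count (not ∘ c)) where

  open Walks G
  open Branches connected acyclic

  private variable
    v w x y : Fin n

  -- Since G is a properly coloured tree, odd r x holds iff x is at odd distance from r.
  odd : Fin n → Fin n → Bool
  odd r x = c x xor c r

  colour-flip : Adj G x y → c y ≡ not (c x)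
  colour-flip {x} {y} x~y = ¬-not (proper x y x~y ∘ sym)

  odd-flip-vertex : Adj G x y → ∀ r → odd r y ≡ not (odd r x)
  odd-flip-vertex {x} x~y r =
    trans (cong (_xor c r) (colour-flip x~y)) (sym (not-distribˡ-xor (c x) (c r)))

  odd-flip-root : Adj G v w → ∀ x → odd w x ≡ not (odd v x)
  odd-flip-root {v} v~w x =
    trans (cong (c x xor_) (colour-flip v~w)) (sym (not-distribʳ-xor (c x) (c v)))

  count-xor : ∀ b → count (λ x → c x xor b) ≡ count c
  count-xor false = count-cong (λ x → xor-identityʳ (c x))
  count-xor true  = trans (count-cong (λ x → xor-comm (c x) true)) (sym balanced)

  #odd-class : ∀ r → count (odd r) ≡ count c
  #odd-class r = count-xor (c r)

  #even-class : ∀ r → count (not ∘ odd r) ≡ count c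
  #even-class r =
    trans (count-cong (λ x → not-distribʳ-xor (c x) (c r))) (count-xor (not (c r)))

  branchCount : Fin n → Fin n → (Fin n → Bool) → ℕ
  branchCount v w k = count (λ x → inBranch v w x ∧ k x)

  branchCount-cong : ∀ v w {k k′ : Fin n → Bool} → (Adj G v w → ∀ x → k x ≡ k′ x) →
                     branchCount v w k ≡ branchCount v w k′
  branchCount-cong v w {k} {k′} k≗k′ = count-cong pointwise
    where
    pointwise : ∀ x → inBranch v w x ∧ k x ≡ inBranch v w x ∧ k′ x
    pointwise x with inBranch v w x in x∈
    ... | true  = k≗k′ (proj₁ (inBranch-sound x∈)) x
    ... | false = refl

  branchCount-nonadjacent : ¬ Adj G v w → ∀ k → branchCount v w k ≡ 0
  branchCount-nonadjacent {v} {w} ¬v~w k = count-false none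
    where
    none : ∀ x → inBranch v w x ∧ k x ≡ false
    none x with inBranch v w x in x∈
    ... | true  = contradiction (proj₁ (inBranch-sound x∈)) ¬v~w
    ... | false = refl

  branchCount-edge : Adj G v w → ∀ k → branchCount v w k + branchCount w v k ≡ count k
  branchCount-edge {v} {w} v~w k = sym (trans (count-split (inBranch v w) k)
    (cong (branchCount v w k +_) (count-cong λ x → cong (_∧ k x) (sym (inBranch-flip v~w x)))))

  ∑-branchCount : ∀ v k {b} → k v ≡ b → 𝟙 b + ∑[ w < n ] branchCount v w k ≡ count k
  ∑-branchCount v k refl = sym (trans (count-remove v k) (cong (𝟙 (k v) +_) (begin
    count (λ x → not (does (x ≟ v)) ∧ k x)         ≡⟨ count≡∑ (λ x → not (does (x ≟ v)) ∧ k x) ⟩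
    ∑[ x < n ] 𝟙 (not (does (x ≟ v)) ∧ k x)        ≡⟨ sum-cong-≗ branches∋ ⟨
    ∑[ x < n ] count (λ w → inBranch v w x ∧ k x)  ≡⟨ count-comm (λ w x → inBranch v w x ∧ k x) ⟨
    ∑[ w < n ] branchCount v w k                   ∎)))
    where
    open ≡-Reasoning
    branches∋ : ∀ x → count (λ w → inBranch v w x ∧ k x) ≡ 𝟙 (not (does (x ≟ v)) ∧ k x)
    branches∋ x with k x
    ... | true  = trans (count-cong (λ w → ∧-identityʳ (inBranch v w x)))
                        (trans (#branches∋ v x) (cong 𝟙 (sym (∧-identityʳ _))))
    ... | false = trans (count-false (λ w → ∧-zeroʳ (inBranch v w x))) (cong 𝟙 (sym (∧-zeroʳ _)))

  #odd #even : Fin n → Fin n → ℕ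
  #odd  v w = branchCount v w (odd w)
  #even v w = branchCount v w (not ∘ odd w)

  #even-reroot : ∀ v w → #even v w ≡ branchCount v w (odd v)
  #even-reroot v w = branchCount-cong v w λ v~w x →
    trans (cong not (odd-flip-root v~w x)) (not-involutive _)

  #odd-reroot : ∀ v w → #odd v w ≡ branchCount v w (not ∘ odd v)
  #odd-reroot v w = branchCount-cong v w odd-flip-root

  ∑#even≡1+∑#odd : ∀ v → ∑[ w < n ] #even v w ≡ suc (∑[ w < n ] #odd v w)
  ∑#even≡1+∑#odd v = begin
    ∑[ w < n ] #even v w                            ≡⟨ sum-cong-≗ (#even-reroot v) ⟩
    ∑[ w < n ] branchCount v w (odd v)              ≡⟨ ∑-branchCount v (odd v) v-even ⟩
    count (odd v)                                   ≡⟨ trans (#odd-class v) (sym (#even-class v)) ⟩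
    count (not ∘ odd v)                             ≡⟨ ∑-branchCount v (not ∘ odd v) (cong not v-even) ⟨
    suc (∑[ w < n ] branchCount v w (not ∘ odd v))  ≡⟨ cong suc (sum-cong-≗ (#odd-reroot v)) ⟨
    suc (∑[ w < n ] #odd v w)                       ∎
    where
    open ≡-Reasoning
    v-even : odd v v ≡ false
    v-even = xor-same (c v)

  #even+#odd : Adj G v w → #even v w + #odd w v ≡ count c
  #even+#odd {v} {w} v~w = begin
    #even v w + #odd w v                ≡⟨ cong (#even v w +_) (branchCount-cong w v odd-flip-root) ⟩
    #even v w + branchCount w v (not ∘ odd w) ≡⟨ branchCount-edge v~w (not ∘ odd w) ⟩
    count (not ∘ odd w)                 ≡⟨ #even-class w ⟩
    count c                             ∎
    where open ≡-Reasoning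

  edge-balance : Adj G v w → #even v w + #odd w v ≡ #even w v + #odd v w
  edge-balance v~w = trans (#even+#odd v~w) (sym (#even+#odd (Adj-sym v~w)))

  root : Fin n → Fin n → Fin n → Fin n
  root v w x = if inBranch v w x then w else v

  cut : Fin n → Fin n → Fin n → Bool
  cut v w x = odd (root v w x) x

  |cut| : Adj G v w → count (cut v w) ≡ #odd v w + #odd w v
  |cut| {v} {w} v~w = begin
    count (cut v w)
      ≡⟨ count-cong (λ x → if-float (λ r → odd r x) (inBranch v w x)) ⟩
    count (λ x → if inBranch v w x then odd w x else odd v x)
      ≡⟨ count-if (inBranch v w) (odd w) (odd v) ⟩
    #odd v w + count (λ x → not (inBranch v w x) ∧ odd v x)
      ≡⟨ cong (#odd v w +_) (count-cong λ x → cong (_∧ odd v x) (sym (inBranch-flip v~w x))) ⟩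
    #odd v w + #odd w v
      ∎
    where open ≡-Reasoning

  |cutᶜ| : Adj G v w → count (not ∘ cut v w) ≡ #even v w + #even w v
  |cutᶜ| {v} {w} v~w = begin
    count (not ∘ cut v w)
      ≡⟨ count-cong (λ x → if-float (λ r → not (odd r x)) (inBranch v w x)) ⟩
    count (λ x → if inBranch v w x then not (odd w x) else not (odd v x))
      ≡⟨ count-if (inBranch v w) (not ∘ odd w) (not ∘ odd v) ⟩
    #even v w + count (λ x → not (inBranch v w x) ∧ not (odd v x))
      ≡⟨ cong (#even v w +_) (count-cong λ x → cong (_∧ not (odd v x)) (sym (inBranch-flip v~w x))) ⟩
    #even v w + #even w v
      ∎
    where open ≡-Reasoning

  root-edge : Adj G v w → Adj G x y →
              root v w x ≡ root v w y ⊎ (x ≡ v × y ≡ w) ⊎ (x ≡ w × y ≡ v)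
  root-edge {v} {w} {x} {y} v~w x~y with inBranch v w x in x∈ | inBranch v w y in y∈
  ... | true  | true  = inj₁ refl
  ... | false | false = inj₁ refl
  ... | false | true  = inj₂ (inj₁
    (branch-cross v~w x~y (inBranch≡false⇒Branch v~w x∈) (proj₂ (inBranch-sound y∈))))
  ... | true  | false = inj₂ (inj₂ (Product.swap
    (branch-cross v~w (Adj-sym x~y) (inBranch≡false⇒Branch v~w y∈) (proj₂ (inBranch-sound x∈)))))

  cut-edge : Adj G v w → Adj G x y → cut v w x ≡ cut v w y → (x ≡ v × y ≡ w) ⊎ (x ≡ w × y ≡ v)
  cut-edge {v} {w} {x} {y} v~w x~y same with root-edge v~w x~y
  ... | inj₂ vw = vw
  ... | inj₁ root≡ = contradiction (begin
    cut v w x                 ≡⟨ same ⟩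
    odd (root v w y) y        ≡⟨ cong (λ r → odd r y) root≡ ⟨
    odd (root v w x) y        ≡⟨ odd-flip-vertex x~y (root v w x) ⟩
    not (cut v w x)           ∎) (not-¬ refl)
    where open ≡-Reasoning

  cut-endˡ : cut v w v ≡ false
  cut-endˡ {v} {w} = trans (cong (λ b → odd (if b then w else v) v) v∉) (xor-same (c v))
    where
    v∉ : inBranch v w v ≡ false
    v∉ = ¬-not (∉Branch ∘ proj₂ ∘ inBranch-sound)

  cut-endʳ : Adj G v w → cut v w w ≡ false
  cut-endʳ {v} {w} v~w = trans (cong (λ b → odd (if b then w else v) w) w∈) (xor-same (c w))
    where
    w∈ : inBranch v w w ≡ true
    w∈ = inBranch-complete v~w (stay (Adj⇒≢ v~w))

  cut-independent : Adj G v w → InducesNoEdge G (cut v w)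
  cut-independent {v} {w} v~w x y x∈ y∈ x~y
    with cut-edge v~w x~y (trans (Equivalence.to T-≡ x∈) (sym (Equivalence.to T-≡ y∈)))
  ... | inj₁ (refl , _) = subst T cut-endˡ x∈
  ... | inj₂ (refl , _) = subst T (cut-endʳ v~w) x∈

  cutᶜ-oneEdge : Adj G v w → InducesExactlyOneEdge G (not ∘ cut v w)
  cutᶜ-oneEdge {v} {w} v~w =
    v , w , from T-not-≡ cut-endˡ , from T-not-≡ (cut-endʳ v~w) , v~w ,
    λ x y x∉ y∉ x~y → cut-edge v~w x~y (trans (to T-not-≡ x∉) (sym (to T-not-≡ y∉)))
    where open Equivalence

  GoodEdge : Fin n → Fin n → Set
  GoodEdge v w = Adj G v w × count (not ∘ cut v w) < count (cut v w)

  goodEdge? : ∀ v w → Dec (GoodEdge v w)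
  goodEdge? v w = T? (adj G v w) ×-dec (count (not ∘ cut v w) <? count (cut v w))

  noGoodEdge⇒perfectMatching : (∀ v w → ¬ GoodEdge v w) → PerfectMatching G
  noGoodEdge⇒perfectMatching noGood =
    surplus⇒perfectMatching G #even #odd #odd≤#even ∑#even≡1+∑#odd
      (λ surplus → surplus-transfer (edge-balance (surplus⇒Adj surplus)) surplus) surplus⇒Adj
    where
    #odd≤#even : ∀ v w → #odd v w ≤ #even v w
    #odd≤#even v w = Sum.[ onEdge , offEdge ]′ (toSum (T? (adj G v w)))
      where
      onEdge : Adj G v w → #odd v w ≤ #even v w
      onEdge v~w = no-deficit (edge-balance v~w) λ cutᶜ<cut →
        noGood v w (v~w , subst₂ _<_ (sym (|cutᶜ| v~w)) (sym (|cut| v~w)) cutᶜ<cut)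
      offEdge : ¬ Adj G v w → #odd v w ≤ #even v w
      offEdge ¬v~w = subst (_≤ #even v w) (sym (branchCount-nonadjacent ¬v~w (odd w))) z≤n

    surplus⇒Adj : ∀ {v w} → #odd v w < #even v w → Adj G v w
    surplus⇒Adj {v} {w} surplus = decidable-stable (T? (adj G v w)) λ ¬v~w →
      contradiction (subst (#odd v w <_) (branchCount-nonadjacent ¬v~w (not ∘ odd w)) surplus)
                    λ ()

  goodEdge-exists : ¬ PerfectMatching G → ∃[ v ] ∃[ w ] GoodEdge v w
  goodEdge-exists noPerfectMatching with any? (λ v → any? (λ w → goodEdge? v w))
  ... | yes good  = good
  ... | no  ¬good = contradiction (noGoodEdge⇒perfectMatching λ v w good → ¬good (v , w , good))
                                  noPerfectMatching

mainTheorem7 : (l : ℕ) (H : Graph (2 * l)) → IsTree H → Equibipartite H →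
    ¬ PerfectMatching H →
    Σ (Fin (2 * l) → Bool) λ V₂ →
      count (λ v → not (V₂ v)) < count V₂ ×
      InducesNoEdge H V₂ ×
      InducesExactlyOneEdge H (λ v → not (V₂ v))
mainTheorem7 l H (connected , acyclic) (c , proper , balanced) noPerfectMatching =
  let v , w , v~w , cutᶜ<cut = goodEdge-exists noPerfectMatching
  in  cut v w , cutᶜ<cut , cut-independent v~w , cutᶜ-oneEdge v~w
  where open EdgeCut connected acyclic c proper balanced
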